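{- Let $T$ be a finite vertex-colored arborescence with colors in $\mathbb{N}$. Then there exists a total ordering $<_T$ of $V(T)$ such that $<_T$ is a depth-first search order of $T$ and, for any two siblings $u$ and $v$ (distinct vertices with the same parent), if $u<_T v$ then $T[u]\leq_{\mathcal{T}_{\mathbb{N}}} T[v]$.
   Context: A vertex-colored arborescence is a finite directed tree $T$ with a root $r$ such that every edge is directed away from $r$, together with a coloring $c:V(T)\to\mathbb{N}$ (not necessarily proper). For $v\in V(T)$, $T[v]$ denotes the subarborescence consisting of $v$ and all its descendants, rooted at $v$, with inherited colors. A depth-first search order of $T$ is a preorder traversal from the root: each vertex precedes all its descendants, and for each vertex the vertices of $T[v]$ form a contiguous block. Arrays are compared lexicographically: $x<y$ iff there is an index $i$ with $x[j]=y[j]$ for all $j<i$ and either $x[i]<y[i]$ (entries being integers or arrays compared recursively), or $x$ has length $i$ while $y$ is longer. The array $\mathrm{L}\mathcal{D}_A$ is defined recursively: if $u$ has no children, $\mathrm{L}\mathcal{D}_A(T[u])=[[\,]]$; otherwise, list the children of $u$ as $n_1,\dots,n_k$ sorted so that $n_a$ precedes $n_b$ whenever $c(n_a)<c(n_b)$, or $c(n_a)=c(n_b)$ and $\mathrm{L}\mathcal{D}_A(T[n_a])<\mathrm{L}\mathcal{D}_A(T[n_b])$ (ties arbitrary), and set $\mathrm{L}\mathcal{D}_A(T[u])=[[c(n_1),\dots,c(n_k)]]+\mathrm{L}\mathcal{D}_A(T[n_1])+\cdots+\mathrm{L}\mathcal{D}_A(T[n_k])$ ($+$ is concatenation). For an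 arborescence $S$ with root $s$, $\overline{\mathrm{L}\mathcal{D}_A}(S)=[[c(s)]]+\mathrm{L}\mathcal{D}_A(S)$. For arborescences $S_1,S_2$, $S_1\leq_{\mathcal{T}_{\mathbb{N}}}S_2$ means $\overline{\mathrm{L}\mathcal{D}_A}(S_1)\leq\overline{\mathrm{L}\mathcal{D}_A}(S_2)$. -}

module Defs where

open import Data.Nat using (ℕ; _<_)
open import Data.Fin using (Fin; zero; suc)
open import Data.List using (List; []; _∷_; map; length; lookup; concatMap)
open import Data.List.Relation.Unary.All using (All)
open import Data.List.Relation.Unary.AllPairs using (AllPairs)
open import Data.List.Relation.Binary.Permutation.Propositional using (_↭_)
open import Data.Product using (Σ; ∃; _×_; _,_; proj₁; proj₂)
open import Data.Sum using (_⊎_)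
open import Relation.Binary.PropositionalEquality using (_≡_)
open import Relation.Nullary using (¬_)

-- The order of the list of children
-- carries no meaning; vertices are identified by their positions.

data Tree : Set where
  node : ℕ → List Tree → Tree

color : Tree → ℕ
color (node c _) = c

children : Tree → List Tree
children (node _ ts) = ts

data Pos : Tree → Set where
  root  : ∀ {t} → Pos t
  child : ∀ {c ts} (i : Fin (length ts)) → Pos (lookup ts i) → Pos (node c ts)

sub : ∀ {t} → Pos t → Tree
sub {t} root        = t
sub (child i p)     = sub p

embed : ∀ {t} (p : Pos t) → Pos (sub p) → Pos t
embed root        q = q
embed (child i p) q = child i (embed p q)

childOf : ∀ {t} (p : Pos t) → Fin (length (children (sub p))) → Pos t
childOf {node c ts} root i = child i root
childOf (child j p) i = child j (childOf p i)

InSub : ∀ {t} → Pos t → Pos t → Set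
InSub u v = Σ (Pos (sub u)) λ w → embed u w ≡ v

ProperDesc : ∀ {t} → Pos t → Pos t → Set
ProperDesc u v = InSub u v × ¬ (u ≡ v)

Siblings : ∀ {t} → Pos t → Pos t → Set
Siblings {t} u v =
  Σ (Pos t) λ r → Σ (Fin (length (children (sub r)))) λ i →
  Σ (Fin (length (children (sub r)))) λ j →
  ¬ (i ≡ j) × u ≡ childOf r i × v ≡ childOf r j

-- A strict order _<T_ on V(T) is a depth-first search order (preorder):
-- each vertex precedes all its (proper) descendants, and for each vertex v
-- the vertices of T[v] form a contiguous block.
IsDFSOrder : ∀ {t} → (Pos t → Pos t → Set) → Set
IsDFSOrder {t} _<T_ =
  (∀ u v → ProperDesc u v → u <T v) ×
  (∀ v a b x → InSub v a → InSub v b → a <T x → x <T b → InSub v x)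

data Lex {A : Set} (_≺_ : A → A → Set) : List A → List A → Set where
  halt : ∀ {y ys} → Lex _≺_ [] (y ∷ ys)
  this : ∀ {x y xs ys} → x ≺ y → Lex _≺_ (x ∷ xs) (y ∷ ys)
  next : ∀ {x xs ys} → Lex _≺_ xs ys → Lex _≺_ (x ∷ xs) (x ∷ ys)

_<₁_ : List ℕ → List ℕ → Set
_<₁_ = Lex _<_

_<₂_ : List (List ℕ) → List (List ℕ) → Set
_<₂_ = Lex _<₁_

_≤₂_ : List (List ℕ) → List (List ℕ) → Set
x ≤₂ y = x <₂ y ⊎ x ≡ y

-- LD_A, defined relationally ("ties arbitrary"): LD T A means A is a
-- value of LD_A(T) for some admissible sorting of the children.

KeyLess : Tree × List (List ℕ) → Tree × List (List ℕ) → Set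
KeyLess (s , a) (s' , a') = color s < color s' ⊎ (color s ≡ color s' × a <₂ a')

SortedKids : List (Tree × List (List ℕ)) → Set
SortedKids = AllPairs (λ x y → ¬ KeyLess y x)

data LD : Tree → List (List ℕ) → Set where
  ld : ∀ {c ts} (ss : List (Tree × List (List ℕ))) →
       map proj₁ ss ↭ ts →
       All (λ s → LD (proj₁ s) (proj₂ s)) ss →
       SortedKids ss →
       LD (node c ts) (map (λ s → color (proj₁ s)) ss ∷ concatMap proj₂ ss)

LDbar : Tree → List (List ℕ) → Set
LDbar s a = Σ (List (List ℕ)) λ a' → LD s a' × a ≡ (color s ∷ []) ∷ a'

_≤T_ : Tree → Tree → Set
s₁ ≤T s₂ = Σ (List (List ℕ)) λ a₁ → Σ (List (List ℕ)) λ a₂ →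
           LDbar s₁ a₁ × LDbar s₂ a₂ × a₁ ≤₂ a₂

-- Compute LD_A canonically by sorting the children n of every vertex by the
-- key [[c(n)]] + LD_A(T[n]), whose lexicographic order refines the order
-- LD_A asks for.  Then traverse T in preorder, visiting the children of each
-- vertex in increasing key, ties broken by position.  Every preorder
-- traversal is a depth-first search order, and the keys of siblings are
-- exactly the arrays that ≤_{T_ℕ} compares.
module Submission where

open import Defs
open import Data.Empty using (⊥-elim)
open import Data.Fin using (Fin) renaming (_<_ to _<ᶠ_)
import Data.Fin.Properties as Fin
open import Data.List using (List; []; _∷_; map; length; lookup; concatMap)
open import Data.List.Properties using (∷-injectiveʳ)
open import Data.List.Relation.Unary.All using (All; []; _∷_)
import Data.List.Relation.Unary.AllPairs as AllPairs
open import Data.List.Relation.Binary.Permutation.Propositional using (_↭_; ↭-sym)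
open import Data.List.Relation.Binary.Permutation.Propositional.Properties using (All-resp-↭; map⁺)
import Data.List.Sort as Sort
open import Data.List.Relation.Unary.Sorted.TotalOrder.Properties using (Sorted⇒AllPairs)
open import Data.Nat using (ℕ)
import Data.Nat.Properties as ℕ
open import Data.Product using (Σ; _×_; _,_; proj₁; proj₂; map₂)
open import Data.Product.Relation.Binary.Lex.Strict using (×-Lex; ×-isStrictTotalOrder)
open import Data.Sum as Sum using (inj₁; inj₂)
open import Function using (_∘_; _on_)
open import Level using (0ℓ)
open import Relation.Binary.Bundles using (DecTotalOrder)
open import Relation.Binary.Core using (Rel; _⇒_)
open import Relation.Binary.Definitions using (Transitive; Trichotomous; tri<; tri≈; tri>)
open import Relation.Binary.Structures using (IsStrictTotalOrder)
open import Relation.Binary.Structures.Biased using (isStrictTotalOrderᶜ)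
open import Relation.Binary.PropositionalEquality
  using (_≡_; _≢_; refl; cong; sym; subst; subst₂; isEquivalence)
import Relation.Binary.Construct.On as On
import Relation.Binary.Construct.StrictToNonStrict as StrictToNonStrict
open import Relation.Nullary using (¬_)

isStrictTotalOrder-≡ : ∀ {a ℓ₁ ℓ₂} {A : Set a} {_≈_ : Rel A ℓ₁} {_<_ : Rel A ℓ₂} →
                       _≈_ ⇒ _≡_ → IsStrictTotalOrder _≈_ _<_ → IsStrictTotalOrder _≡_ _<_
isStrictTotalOrder-≡ {_<_ = _<_} ≈⇒≡ sto = isStrictTotalOrderᶜ record
  { isEquivalence = isEquivalence
  ; trans         = trans
  ; compare       = compare-≡
  }
  where
  open IsStrictTotalOrder sto using (trans; compare; module Eq)
  compare-≡ : Trichotomous _≡_ _<_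
  compare-≡ x y with compare x y
  ... | tri< x<y x≉y x≯y = tri< x<y (x≉y ∘ Eq.reflexive) x≯y
  ... | tri≈ x≮y x≈y x≯y = tri≈ x≮y (≈⇒≡ x≈y) x≯y
  ... | tri> x≮y x≉y x>y = tri> x≮y (x≉y ∘ Eq.reflexive) x>y

module _ {A : Set} {_≺_ : Rel A 0ℓ} (sto : IsStrictTotalOrder _≡_ _≺_) where
  open IsStrictTotalOrder sto using (trans; compare; irrefl; asym)

  Lex-trans : Transitive (Lex _≺_)
  Lex-trans halt     (this _) = halt
  Lex-trans halt     (next _) = halt
  Lex-trans (this p) (this q) = this (trans p q)
  Lex-trans (this p) (next _) = this p
  Lex-trans (next _) (this q) = this q
  Lex-trans (next p) (next q) = next (Lex-trans p q)

  Lex-compare : Trichotomous _≡_ (Lex _≺_)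
  Lex-compare []       []       = tri≈ (λ ()) refl (λ ())
  Lex-compare []       (y ∷ ys) = tri< halt (λ ()) (λ ())
  Lex-compare (x ∷ xs) []       = tri> (λ ()) (λ ()) halt
  Lex-compare (x ∷ xs) (y ∷ ys) with compare x y
  ... | tri< x≺y _ _ = tri< (this x≺y) (λ { refl → irrefl refl x≺y })
                            (λ { (this y≺x) → asym x≺y y≺x ; (next _) → irrefl refl x≺y })
  ... | tri> _ _ y≺x = tri> (λ { (this x≺y) → asym x≺y y≺x ; (next _) → irrefl refl y≺x })
                            (λ { refl → irrefl refl y≺x }) (this y≺x)
  ... | tri≈ _ refl _ with Lex-compare xs ys
  ...   | tri< xs<ys xs≢ys xs≯ys = tri< (next xs<ys) (xs≢ys ∘ ∷-injectiveʳ)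
                                       (λ { (this x≺x) → irrefl refl x≺x ; (next ys<xs) → xs≯ys ys<xs })
  ...   | tri≈ xs≮ys refl xs≯ys = tri≈ (λ { (this x≺x) → irrefl refl x≺x ; (next xs<ys) → xs≮ys xs<ys }) refl
                                      (λ { (this x≺x) → irrefl refl x≺x ; (next ys<xs) → xs≯ys ys<xs })
  ...   | tri> xs≮ys xs≢ys ys<xs = tri> (λ { (this x≺x) → irrefl refl x≺x ; (next xs<ys) → xs≮ys xs<ys })
                                       (xs≢ys ∘ ∷-injectiveʳ) (next ys<xs)

  Lex-isStrictTotalOrder : IsStrictTotalOrder _≡_ (Lex _≺_)
  Lex-isStrictTotalOrder = isStrictTotalOrderᶜ record
    { isEquivalence = isEquivalence
    ; trans         = Lex-trans
    ; compare       = Lex-compare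
    }

<₂-isStrictTotalOrder : IsStrictTotalOrder _≡_ _<₂_
<₂-isStrictTotalOrder = Lex-isStrictTotalOrder (Lex-isStrictTotalOrder ℕ.<-isStrictTotalOrder)

open IsStrictTotalOrder <₂-isStrictTotalOrder using () renaming (asym to <₂-asym; irrefl to <₂-irrefl)

≤₂⇒≯₂ : ∀ {xs ys} → xs ≤₂ ys → ¬ ys <₂ xs
≤₂⇒≯₂ (inj₁ xs<ys) = <₂-asym xs<ys
≤₂⇒≯₂ (inj₂ refl)  = <₂-irrefl refl

Item : Set
Item = Tree × List (List ℕ)

key : Item → List (List ℕ)
key (s , a) = (color s ∷ []) ∷ a

KeyLess⇒key<₂ : ∀ x y → KeyLess x y → key x <₂ key y
KeyLess⇒key<₂ _       _         (inj₁ c<c')          = this (this c<c')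
KeyLess⇒key<₂ (s , a) (s' , a') (inj₂ (c≡c' , a<a')) rewrite c≡c' = next a<a'

itemOrder : DecTotalOrder 0ℓ 0ℓ 0ℓ
itemOrder = On.decTotalOrder
  (record { isDecTotalOrder = StrictToNonStrict.isDecTotalOrder _≡_ _<₂_ <₂-isStrictTotalOrder })
  key

open Sort itemOrder using (sort; sort-↭; sort-↗)

sort-SortedKids : ∀ xs → SortedKids (sort xs)
sort-SortedKids xs = AllPairs.map (λ {x} {y} x≤y → ≤₂⇒≯₂ x≤y ∘ KeyLess⇒key<₂ y x)
  (Sorted⇒AllPairs (DecTotalOrder.totalOrder itemOrder) (sort-↗ xs))

-- `withLD` is `map (λ t → t , sortedLD t)`, spelled out for the termination checker.
mutual
  sortedLD : Tree → List (List ℕ)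
  sortedLD (node _ ts) = map (color ∘ proj₁) (sort (withLD ts)) ∷ concatMap proj₂ (sort (withLD ts))

  withLD : List Tree → List Item
  withLD []       = []
  withLD (t ∷ ts) = (t , sortedLD t) ∷ withLD ts

map-proj₁-withLD : ∀ ts → map proj₁ (withLD ts) ≡ ts
map-proj₁-withLD []       = refl
map-proj₁-withLD (t ∷ ts) = cong (t ∷_) (map-proj₁-withLD ts)

mutual
  sortedLD-LD : ∀ t → LD t (sortedLD t)
  sortedLD-LD (node _ ts) = ld (sort (withLD ts))
    (subst (map proj₁ (sort (withLD ts)) ↭_) (map-proj₁-withLD ts) (map⁺ proj₁ (sort-↭ (withLD ts))))
    (All-resp-↭ (↭-sym (sort-↭ (withLD ts))) (withLD-LD ts))
    (sort-SortedKids (withLD ts))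

  withLD-LD : ∀ ts → All (λ s → LD (proj₁ s) (proj₂ s)) (withLD ts)
  withLD-LD []       = []
  withLD-LD (t ∷ ts) = sortedLD-LD t ∷ withLD-LD ts

ldBar : Tree → List (List ℕ)
ldBar t = key (t , sortedLD t)

ldBar-≤₂⇒≤T : ∀ {s s'} → ldBar s ≤₂ ldBar s' → s ≤T s'
ldBar-≤₂⇒≤T {s} {s'} le = ldBar s , ldBar s' , (_ , sortedLD-LD s , refl) , (_ , sortedLD-LD s' , refl) , le

sub-childOf : ∀ {t} (r : Pos t) i → sub (childOf r i) ≡ lookup (children (sub r)) i
sub-childOf {node _ _} root        i = refl
sub-childOf            (child _ r) i = sub-childOf r i

module PreorderTraversal
  (SiblingOrder : (ts : List Tree) → Rel (Fin (length ts)) 0ℓ)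
  (SiblingOrder-isStrictTotalOrder : ∀ ts → IsStrictTotalOrder _≡_ (SiblingOrder ts))
  where

  private
    module Sibling {ts} = IsStrictTotalOrder (SiblingOrder-isStrictTotalOrder ts)

  data _⊏_ : {t : Tree} → Pos t → Pos t → Set where
    root⊏child   : ∀ {c ts i p} → _⊏_ {node c ts} root (child i p)
    across     : ∀ {c ts i j p q} → SiblingOrder ts i j → _⊏_ {node c ts} (child i p) (child j q)
    within     : ∀ {c ts i p q} → p ⊏ q → _⊏_ {node c ts} (child i p) (child i q)

  ⊏-within⁻ : ∀ {c ts i} {p q : Pos (lookup ts i)} → _⊏_ {node c ts} (child i p) (child i q) → p ⊏ q
  ⊏-within⁻ (across i≺i) = ⊥-elim (Sibling.irrefl refl i≺i)
  ⊏-within⁻ (within p⊏q) = p⊏q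

  ⊏-trans : ∀ {t} → Transitive (_⊏_ {t})
  ⊏-trans root⊏child   (across _)   = root⊏child
  ⊏-trans root⊏child   (within _)   = root⊏child
  ⊏-trans (across i≺j) (across j≺k) = across (Sibling.trans i≺j j≺k)
  ⊏-trans (across i≺j) (within _)   = across i≺j
  ⊏-trans (within _)   (across j≺k) = across j≺k
  ⊏-trans (within p⊏q) (within q⊏r) = within (⊏-trans p⊏q q⊏r)

  ⊏-compare : ∀ {t} → Trichotomous _≡_ (_⊏_ {t})
  ⊏-compare root        root        = tri≈ (λ ()) refl (λ ())
  ⊏-compare root        (child i p) = tri< root⊏child (λ ()) (λ ())
  ⊏-compare (child i p) root        = tri> (λ ()) (λ ()) root⊏child
  ⊏-compare {node _ ts} (child i p) (child j q) with Sibling.compare {ts} i j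
  ... | tri< i≺j _ _ = tri< (across i≺j) (λ { refl → Sibling.irrefl refl i≺j })
                            (λ { (across j≺i) → Sibling.asym i≺j j≺i ; (within _) → Sibling.irrefl refl i≺j })
  ... | tri> _ _ j≺i = tri> (λ { (across i≺j) → Sibling.asym i≺j j≺i ; (within _) → Sibling.irrefl refl j≺i })
                            (λ { refl → Sibling.irrefl refl j≺i }) (across j≺i)
  ... | tri≈ _ refl _ with ⊏-compare p q
  ...   | tri< p⊏q p≢q q⋢p  = tri< (within p⊏q) (λ { refl → p≢q refl }) (q⋢p ∘ ⊏-within⁻)
  ...   | tri≈ p⋢q refl q⋢p = tri≈ (p⋢q ∘ ⊏-within⁻) refl (q⋢p ∘ ⊏-within⁻)
  ...   | tri> p⋢q p≢q q⊏p  = tri> (p⋢q ∘ ⊏-within⁻) (λ { refl → p≢q refl }) (within q⊏p)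

  ⊏-isStrictTotalOrder : ∀ {t} → IsStrictTotalOrder _≡_ (_⊏_ {t})
  ⊏-isStrictTotalOrder = isStrictTotalOrderᶜ record
    { isEquivalence = isEquivalence
    ; trans         = ⊏-trans
    ; compare       = ⊏-compare
    }

  ⊏-descendant : ∀ {t} (u v : Pos t) → ProperDesc u v → u ⊏ v
  ⊏-descendant root        _ ((root , refl) , u≢v)    = ⊥-elim (u≢v refl)
  ⊏-descendant root        _ ((child i w , refl) , _) = root⊏child
  ⊏-descendant (child i u) _ ((w , refl) , u≢v)       =
    within (⊏-descendant u (embed u w) ((w , refl) , u≢v ∘ cong (child i)))

  ⊏-contiguous : ∀ {t} (v a b x : Pos t) → InSub v a → InSub v b → a ⊏ x → x ⊏ b → InSub v x
  ⊏-contiguous root        _ _ x _ _ _ _ = x , refl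
  ⊏-contiguous (child i v) _ _ _ (_ , refl) (_ , refl) (across i≺k) (across k≺i) =
    ⊥-elim (Sibling.asym i≺k k≺i)
  ⊏-contiguous (child i v) _ _ _ (_ , refl) (_ , refl) (across i≺i) (within _) =
    ⊥-elim (Sibling.irrefl refl i≺i)
  ⊏-contiguous (child i v) _ _ _ (_ , refl) (_ , refl) (within _) (across i≺i) =
    ⊥-elim (Sibling.irrefl refl i≺i)
  ⊏-contiguous (child i v) _ _ (child i x) (a , refl) (b , refl) (within a⊏x) (within x⊏b) =
    map₂ (cong (child i)) (⊏-contiguous v (embed v a) (embed v b) x (a , refl) (b , refl) a⊏x x⊏b)

  ⊏-isDFSOrder : ∀ {t} → IsDFSOrder (_⊏_ {t})
  ⊏-isDFSOrder = ⊏-descendant , ⊏-contiguous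

  ⊏-childOf⁻ : ∀ {t} (r : Pos t) {i j} → i ≢ j → childOf r i ⊏ childOf r j →
               SiblingOrder (children (sub r)) i j
  ⊏-childOf⁻ {node _ _} root        i≢j (across i≺j) = i≺j
  ⊏-childOf⁻ {node _ _} root        i≢j (within _)   = ⊥-elim (i≢j refl)
  ⊏-childOf⁻            (child _ r) i≢j ri⊏rj        = ⊏-childOf⁻ r i≢j (⊏-within⁻ ri⊏rj)

keyedIndex : (ts : List Tree) → Fin (length ts) → List (List ℕ) × Fin (length ts)
keyedIndex ts i = ldBar (lookup ts i) , i

KeyOrder : (ts : List Tree) → Rel (Fin (length ts)) 0ℓ
KeyOrder ts = ×-Lex _≡_ _<₂_ _<ᶠ_ on keyedIndex ts

KeyOrder-isStrictTotalOrder : ∀ ts → IsStrictTotalOrder _≡_ (KeyOrder ts)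
KeyOrder-isStrictTotalOrder ts = isStrictTotalOrder-≡ proj₂
  (On.isStrictTotalOrder (keyedIndex ts)
    (×-isStrictTotalOrder <₂-isStrictTotalOrder Fin.<-isStrictTotalOrder))

open PreorderTraversal KeyOrder KeyOrder-isStrictTotalOrder

proposition3p5 : (T : Tree) →
    Σ (Pos T → Pos T → Set) λ _<T_ →
      IsStrictTotalOrder _≡_ _<T_ × IsDFSOrder _<T_ ×
      (∀ u v → Siblings u v → u <T v → sub u ≤T sub v)
proposition3p5 T = _⊏_ , ⊏-isStrictTotalOrder , ⊏-isDFSOrder , siblings-⊏⇒≤T
  where
  siblings-⊏⇒≤T : ∀ u v → Siblings u v → u ⊏ v → sub u ≤T sub v
  siblings-⊏⇒≤T _ _ (r , i , j , i≢j , refl , refl) ri⊏rj =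
    subst₂ _≤T_ (sym (sub-childOf r i)) (sym (sub-childOf r j))
      (ldBar-≤₂⇒≤T (Sum.map₂ proj₁ (⊏-childOf⁻ r i≢j ri⊏rj)))
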